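{- Let $\lambda=(\lambda_n)_{n\ge1}$ be a sequence (in a commutative ring), and define $(\mu_n)_{n\ge0}$ and $(\nu_n)_{n\ge0}$ by \[ \sum_{n\ge0}\mu_nz^n=\cfrac{1}{1-\cfrac{\lambda_1z}{1-\cfrac{\lambda_2z}{1-\cdots}}},\qquad \sum_{n\ge0}\nu_nz^n=\cfrac{1}{1+z-\cfrac{\lambda_1z}{1+z-\cfrac{\lambda_2z}{1+z-\cdots}}}. \] Then for every $n\ge0$, $\mu_n=\sum_{k=0}^{n}\left(\binom{2n}{n-k}-\binom{2n}{n-k-1}\right)\nu_k$.
   Context: Infinite continued fractions are formal power series in $z$, limits of their finite truncations. Binomial coefficients with negative lower index are $0$. -}

module Defs where

open import Level using (Level)
open import Data.Nat as ℕ using (ℕ; zero; suc; _∸_; _<_; _≤_)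
open import Data.Nat.Combinatorics using (_C_)
open import Data.Nat.Properties using (_<?_)
open import Data.Product using (∃; _,_)
open import Relation.Nullary using (yes; no)
open import Algebra.Bundles using (CommutativeRing)

module FPS {c ℓ : Level} (R : CommutativeRing c ℓ) where
  open CommutativeRing R

  Series : Set c
  Series = ℕ → Carrier

  sumTo : ℕ → (ℕ → Carrier) → Carrier
  sumTo zero    f = 0#
  sumTo (suc n) f = sumTo n f + f n

  fromℕ : ℕ → Carrier
  fromℕ zero    = 0#
  fromℕ (suc n) = 1# + fromℕ n

  one : Series
  one zero    = 1#
  one (suc _) = 0#

  zS : Series
  zS 1 = 1#
  zS _ = 0#

  _⊕_ : Series → Series → Series
  (f ⊕ g) n = f n + g n

  ⊝_ : Series → Series
  (⊝ f) n = - f n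

  scale : Carrier → Series → Series
  scale a f n = a * f n

  _⊛_ : Series → Series → Series
  (f ⊛ g) n = sumTo (suc n) (λ i → f i * g (n ∸ i))

  pow : Series → ℕ → Series
  pow f zero    = one
  pow f (suc k) = f ⊛ pow f k

  -- multiplicative inverse of a series u with u 0 = 1, as the geometric series
  -- Σ_{k ≥ 0} (1 - u)^k ; only k ≤ n contributes to the n-th coefficient since
  -- (1 - u) has zero constant term.
  inv1 : Series → Series
  inv1 u n = sumTo (suc n) (λ k → pow (one ⊕ (⊝ u)) k n)

  -- lam i stands for λ_i (i ≥ 1); lam 0 is never used.
  -- Truncations of  1/(1 - λ_{j+1} z/(1 - λ_{j+2} z/(1 - ...))) at depth d
  -- (depth 0 is the constant 1).
  stieltjesTrunc : (ℕ → Carrier) → ℕ → ℕ → Series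
  stieltjesTrunc lam zero    j = one
  stieltjesTrunc lam (suc d) j =
    inv1 (one ⊕ (⊝ (scale (lam (suc j)) (zS ⊛ stieltjesTrunc lam d (suc j)))))

  nuTrunc : (ℕ → Carrier) → ℕ → ℕ → Series
  nuTrunc lam zero    j = one
  nuTrunc lam (suc d) j =
    inv1 ((one ⊕ zS) ⊕ (⊝ (scale (lam (suc j)) (zS ⊛ nuTrunc lam d (suc j)))))

  IsLimit : (ℕ → Series) → Series → Set ℓ
  IsLimit f s = ∀ n → ∃ λ D → ∀ d → D ≤ d → f d n ≈ s n

  -- binomial coefficient with possibly negative lower index (zero if negative)
  -- C(2n, n-k) - C(2n, n-k-1), for k ≤ n (C with negative lower index is 0)
  ballot : ℕ → ℕ → Carrier
  ballot n k with k <? n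
  ... | yes _ = fromℕ ((2 ℕ.* n) C (n ∸ k)) + (- fromℕ ((2 ℕ.* n) C (n ∸ k ∸ 1)))
  ... | no  _ = fromℕ ((2 ℕ.* n) C (n ∸ k))

module Submission where

open import Defs
open import Level using (Level)
open import Data.Nat as ℕ using (ℕ; zero; suc; z≤n; s≤s; _∸_; _<_; _≤_)
import Data.Nat.Properties as ℕₚ
open import Data.Nat.Properties using (_<?_)
open import Data.Nat.Combinatorics using (_C_; nCk+nC[k+1]≡[n+1]C[k+1]; nCk≡nC[n∸k])
open import Data.Sum using (inj₁; inj₂)
open import Data.Product using (_×_; _,_; ∃)
open import Data.Maybe using (nothing)
open import Relation.Nullary using (yes; no)
open import Algebra.Bundles using (CommutativeRing)
open import Relation.Binary.PropositionalEquality as ≡ using (_≡_)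
open import Tactic.RingSolver.Core.AlmostCommutativeRing using (fromCommutativeRing)
import Relation.Binary.Reasoning.Setoid as SetoidReasoning
import Tactic.RingSolver.NonReflective as RingSolver

module Summation {c ℓ : Level} (R : CommutativeRing c ℓ) where
  open CommutativeRing R
  open FPS R using (sumTo)
  open SetoidReasoning setoid
  open RingSolver (fromCommutativeRing R (λ _ → nothing)) using (solve; _⊜_) renaming (_⊕_ to _:+_)

  sum-cong : ∀ n {f g : ℕ → Carrier} → (∀ i → i < n → f i ≈ g i) → sumTo n f ≈ sumTo n g
  sum-cong zero    f≈g = refl
  sum-cong (suc n) f≈g = +-cong (sum-cong n (λ i i<n → f≈g i (ℕₚ.m<n⇒m<1+n i<n))) (f≈g n ℕₚ.≤-refl)

  sum-zero : ∀ n {f : ℕ → Carrier} → (∀ i → i < n → f i ≈ 0#) → sumTo n f ≈ 0#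
  sum-zero n f≈0 = trans (sum-cong n f≈0) (all-zero n)
    where
    all-zero : ∀ n → sumTo n (λ _ → 0#) ≈ 0#
    all-zero zero    = refl
    all-zero (suc n) = trans (+-identityʳ _) (all-zero n)

  sum-+ : ∀ n (f g : ℕ → Carrier) → sumTo n (λ i → f i + g i) ≈ sumTo n f + sumTo n g
  sum-+ zero    f g = sym (+-identityˡ 0#)
  sum-+ (suc n) f g = trans (+-cong (sum-+ n f g) refl)
    (solve 4 (λ A B a b → ((A :+ B) :+ (a :+ b)) ⊜ ((A :+ a) :+ (B :+ b))) refl _ _ _ _)

  sum-*ˡ : ∀ n a (f : ℕ → Carrier) → a * sumTo n f ≈ sumTo n (λ i → a * f i)
  sum-*ˡ zero    a f = zeroʳ a
  sum-*ˡ (suc n) a f = trans (distribˡ a _ _) (+-cong (sum-*ˡ n a f) refl)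

  -- Negation is the scalar -1, so it also passes through sums.
  sum-neg : ∀ n (f : ℕ → Carrier) → - sumTo n f ≈ sumTo n (λ i → - f i)
  sum-neg n f = begin
    - sumTo n f                    ≈⟨ sym (-1*x≈-x _) ⟩
    - 1# * sumTo n f               ≈⟨ sum-*ˡ n (- 1#) f ⟩
    sumTo n (λ i → - 1# * f i)     ≈⟨ sum-cong n (λ i _ → -1*x≈-x (f i)) ⟩
    sumTo n (λ i → - f i)          ∎
    where open import Algebra.Properties.Ring ring using (-1*x≈-x)

  sum-head : ∀ n (f : ℕ → Carrier) → sumTo (suc n) f ≈ f 0 + sumTo n (λ i → f (suc i))
  sum-head zero    f = +-comm 0# (f 0)
  sum-head (suc n) f = trans (+-cong (sum-head n f) refl) (+-assoc _ _ _)

  sum-swap : ∀ a b (F : ℕ → ℕ → Carrier) →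
    sumTo a (λ i → sumTo b (λ j → F i j)) ≈ sumTo b (λ j → sumTo a (λ i → F i j))
  sum-swap zero    b F = sym (sum-zero b (λ _ _ → refl))
  sum-swap (suc a) b F = trans (+-cong (sum-swap a b F) refl) (sym (sum-+ b _ _))

  sum-pad : ∀ {a} b (f : ℕ → Carrier) → a ≤ b → (∀ i → a ≤ i → i < b → f i ≈ 0#) →
    sumTo b f ≈ sumTo a f
  sum-pad zero    f z≤n f≈0 = refl
  sum-pad {a} (suc b) f a≤b f≈0 with ℕₚ.m≤n⇒m<n∨m≡n a≤b
  ... | inj₂ ≡.refl       = refl
  ... | inj₁ (s≤s a≤b′) = begin
    sumTo b f + f b  ≈⟨ +-cong (sum-pad b f a≤b′ (λ i a≤i i<b → f≈0 i a≤i (ℕₚ.m<n⇒m<1+n i<b)))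
                               (f≈0 b a≤b′ ℕₚ.≤-refl) ⟩
    sumTo a f + 0#   ≈⟨ +-identityʳ _ ⟩
    sumTo a f        ∎

  sum-product : ∀ a b (f g : ℕ → Carrier) →
    sumTo a f * sumTo b g ≈ sumTo a (λ i → sumTo b (λ j → f i * g j))
  sum-product a b f g = begin
    sumTo a f * sumTo b g                         ≈⟨ *-comm _ _ ⟩
    sumTo b g * sumTo a f                         ≈⟨ sum-*ˡ a _ f ⟩
    sumTo a (λ i → sumTo b g * f i)               ≈⟨ sum-cong a (λ i _ → trans (*-comm _ _) (sum-*ˡ b (f i) g)) ⟩
    sumTo a (λ i → sumTo b (λ j → f i * g j))     ∎

module SeriesAlgebra {c ℓ : Level} (R : CommutativeRing c ℓ) where
  open CommutativeRing R
  open FPS R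
  open Summation R
  open SetoidReasoning setoid
  open import Algebra.Properties.Group +-group using (x∙y⁻¹≈ε⇒x≈y; ∙-cancelʳ; ε⁻¹≈ε)

  one-⊛ : ∀ (g : Series) n → (one ⊛ g) n ≈ g n
  one-⊛ g n = begin
    (one ⊛ g) n                                    ≈⟨ sum-head n _ ⟩
    1# * g n + sumTo n (λ i → 0# * g (n ∸ suc i))  ≈⟨ +-cong (*-identityˡ _) (sum-zero n (λ i _ → zeroˡ _)) ⟩
    g n + 0#                                       ≈⟨ +-identityʳ _ ⟩
    g n                                            ∎

  ⊛-+ : ∀ (f f′ g : Series) n → (f ⊛ g) n + (f′ ⊛ g) n ≈ ((f ⊕ f′) ⊛ g) n
  ⊛-+ f f′ g n = trans (sym (sum-+ (suc n) _ _)) (sum-cong (suc n) (λ i _ → sym (distribʳ _ _ _)))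

  -- The part of  (z g)_{n+1}  coming from the positive powers of z is  g_n.
  zS-tail : ∀ (g : Series) n → sumTo (suc n) (λ i → zS (suc i) * g (n ∸ i)) ≈ g n
  zS-tail g n = begin
    sumTo (suc n) (λ i → zS (suc i) * g (n ∸ i))   ≈⟨ sum-head n _ ⟩
    1# * g n + sumTo n (λ i → 0# * g (n ∸ suc i))  ≈⟨ +-cong (*-identityˡ _) (sum-zero n (λ i _ → zeroˡ _)) ⟩
    g n + 0#                                       ≈⟨ +-identityʳ _ ⟩
    g n                                            ∎

  zS-⊛-zero : ∀ (f : Series) → (zS ⊛ f) 0 ≈ 0#
  zS-⊛-zero f = trans (+-identityˡ _) (zeroˡ _)

  zS-⊛-suc : ∀ (f : Series) n → (zS ⊛ f) (suc n) ≈ f n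
  zS-⊛-suc f n = begin
    (zS ⊛ f) (suc n)                                              ≈⟨ sum-head (suc n) _ ⟩
    0# * f (suc n) + sumTo (suc n) (λ i → zS (suc i) * f (n ∸ i))  ≈⟨ +-cong (zeroˡ _) (zS-tail f n) ⟩
    0# + f n                                                       ≈⟨ +-identityˡ _ ⟩
    f n                                                            ∎

  pow-order : ∀ (v : Series) → v 0 ≈ 0# → ∀ k m → m < k → pow v k m ≈ 0#
  pow-order v v0≈0 (suc k) zero    _           = trans (+-identityˡ _) (trans (*-cong v0≈0 refl) (zeroˡ _))
  pow-order v v0≈0 (suc k) (suc m) (s≤s m<k) = begin
    (v ⊛ pow v k) (suc m)                                                  ≈⟨ sum-head (suc m) _ ⟩
    v 0 * pow v k (suc m) + sumTo (suc m) (λ i → v (suc i) * pow v k (m ∸ i))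
      ≈⟨ +-cong (trans (*-cong v0≈0 refl) (zeroˡ _))
                (sum-zero (suc m) (λ i _ → trans (*-cong refl (pow-order v v0≈0 k (m ∸ i)
                                                     (ℕₚ.≤-<-trans (ℕₚ.m∸n≤m m i) m<k))) (zeroʳ _))) ⟩
    0# + 0#                                                                ≈⟨ +-identityˡ 0# ⟩
    0#                                                                     ∎

  -- If u 0 = 1 then inv1 u = Σ_k (1 - u)^k satisfies u · inv1 u = 1.  Writing
  -- v = 1 - u, the geometric series g satisfies g = 1 + v g, whence u g = g - v g = 1.
  module _ (u : Series) (u0≈1 : u 0 ≈ 1#) where
    private
      v : Series
      v = one ⊕ (⊝ u)

      g : Series
      g = inv1 u

      v0≈0 : v 0 ≈ 0#
      v0≈0 = trans (+-cong refl (-‿cong u0≈1)) (-‿inverseʳ 1#)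

      g-trunc : ∀ n M → n ≤ M → sumTo (suc M) (λ k → pow v k n) ≈ g n
      g-trunc n M n≤M = sum-pad (suc M) _ (s≤s n≤M) (λ k n<k _ → pow-order v v0≈0 k n n<k)

      v⊛g : ∀ n → (v ⊛ g) n ≈ sumTo (suc n) (λ k → pow v (suc k) n)
      v⊛g n = begin
        (v ⊛ g) n
          ≈⟨ sum-cong (suc n) (λ i _ → *-cong refl (sym (g-trunc (n ∸ i) n (ℕₚ.m∸n≤m n i)))) ⟩
        sumTo (suc n) (λ i → v i * sumTo (suc n) (λ k → pow v k (n ∸ i)))
          ≈⟨ sum-cong (suc n) (λ i _ → sum-*ˡ (suc n) (v i) _) ⟩
        sumTo (suc n) (λ i → sumTo (suc n) (λ k → v i * pow v k (n ∸ i)))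
          ≈⟨ sum-swap (suc n) (suc n) _ ⟩
        sumTo (suc n) (λ k → pow v (suc k) n)  ∎

      g≈1+v⊛g : ∀ n → g n ≈ one n + (v ⊛ g) n
      g≈1+v⊛g n = begin
        g n                                                 ≈⟨ sym (+-identityʳ _) ⟩
        g n + 0#                                            ≈⟨ +-cong refl (sym (pow-order v v0≈0 (suc n) n ℕₚ.≤-refl)) ⟩
        sumTo (suc (suc n)) (λ k → pow v k n)               ≈⟨ sum-head (suc n) _ ⟩
        one n + sumTo (suc n) (λ k → pow v (suc k) n)       ≈⟨ +-cong refl (sym (v⊛g n)) ⟩
        one n + (v ⊛ g) n                                   ∎

    inverse-law : ∀ n → (u ⊛ inv1 u) n ≈ one n
    inverse-law n = ∙-cancelʳ ((v ⊛ g) n) _ _ (begin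
      (u ⊛ g) n + (v ⊛ g) n  ≈⟨ ⊛-+ u v g n ⟩
      ((u ⊕ v) ⊛ g) n        ≈⟨ sum-cong (suc n) (λ i _ → *-cong (u+v≈one i) refl) ⟩
      (one ⊛ g) n            ≈⟨ one-⊛ g n ⟩
      g n                    ≈⟨ g≈1+v⊛g n ⟩
      one n + (v ⊛ g) n      ∎)
      where
      u+v≈one : ∀ i → u i + (one i + - u i) ≈ one i
      u+v≈one i = trans (+-cong refl (+-comm _ _)) (trans (sym (+-assoc _ _ _))
                    (trans (+-cong (-‿inverseʳ _) refl) (+-identityˡ _)))

    -- Degree n+1 of  u · inv1 u = 1.
    inverse-recurrence : ∀ n → inv1 u (suc n) + sumTo (suc n) (λ i → u (suc i) * inv1 u (n ∸ i)) ≈ 0#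
    inverse-recurrence n = begin
      g (suc n) + sumTo (suc n) (λ i → u (suc i) * g (n ∸ i))
        ≈⟨ +-cong (sym (trans (*-cong u0≈1 refl) (*-identityˡ _))) refl ⟩
      u 0 * g (suc n) + sumTo (suc n) (λ i → u (suc i) * g (n ∸ i))  ≈⟨ sym (sum-head (suc n) _) ⟩
      (u ⊛ g) (suc n)                                               ≈⟨ inverse-law (suc n) ⟩
      0#                                                            ∎

  -- g = 1/(1 - L z f), expressed through coefficients.
  IsStieltjesStep : Carrier → Series → Series → Set ℓ
  IsStieltjesStep L f g = (g 0 ≈ 1#) × (∀ n → g (suc n) ≈ L * (f ⊛ g) n)

  -- H = 1/(1 + z - L z h), expressed through coefficients.
  IsNuStep : Carrier → Series → Series → Set ℓ
  IsNuStep L h H = (H 0 ≈ 1#) × (∀ n → H (suc n) + H n ≈ L * (h ⊛ H) n)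

  private
    neg-scaled-⊛ : ∀ L (f g : Series) n → sumTo (suc n) (λ i → - (L * f i) * g (n ∸ i)) ≈ - (L * (f ⊛ g) n)
    neg-scaled-⊛ L f g n = begin
      sumTo (suc n) (λ i → - (L * f i) * g (n ∸ i))  ≈⟨ sum-cong (suc n) (λ i _ → neg-assoc (f i) (g (n ∸ i))) ⟩
      sumTo (suc n) (λ i → - (L * (f i * g (n ∸ i)))) ≈⟨ sym (sum-neg (suc n) _) ⟩
      - sumTo (suc n) (λ i → L * (f i * g (n ∸ i)))  ≈⟨ -‿cong (sym (sum-*ˡ (suc n) L _)) ⟩
      - (L * (f ⊛ g) n)                               ∎
      where
      open import Algebra.Properties.Ring ring using (-‿distribˡ-*)
      neg-assoc : ∀ a b → - (L * a) * b ≈ - (L * (a * b))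
      neg-assoc a b = trans (sym (-‿distribˡ-* _ _)) (-‿cong (*-assoc _ _ _))

    -- The denominators  1 - L z f  and  1 + z - L z h  have constant term 1.
    no-constant : ∀ L (f : Series) → - (L * (zS ⊛ f) 0) ≈ 0#
    no-constant L f = trans (-‿cong (trans (*-cong refl (zS-⊛-zero f)) (zeroʳ L))) ε⁻¹≈ε

  -- In both steps the constant term  inv1 u 0  is  0 + 1  by definition, and the
  -- higher coefficients follow from the inverse recurrence.
  stieltjes-step : ∀ L (f : Series) → IsStieltjesStep L f (inv1 (one ⊕ (⊝ (scale L (zS ⊛ f)))))
  stieltjes-step L f = +-identityˡ 1# , λ n → x∙y⁻¹≈ε⇒x≈y _ _ (begin
      g (suc n) + - (L * (f ⊛ g) n)                           ≈⟨ +-cong refl (sym (neg-scaled-⊛ L f g n)) ⟩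
      g (suc n) + sumTo (suc n) (λ i → - (L * f i) * g (n ∸ i))
        ≈⟨ +-cong refl (sum-cong (suc n) (λ i _ → *-cong (sym (u-suc i)) refl)) ⟩
      g (suc n) + sumTo (suc n) (λ i → u (suc i) * g (n ∸ i))  ≈⟨ inverse-recurrence u u0≈1 n ⟩
      0#                                                        ∎)
    where
    u : Series
    u = one ⊕ (⊝ (scale L (zS ⊛ f)))
    g : Series
    g = inv1 u
    u0≈1 : u 0 ≈ 1#
    u0≈1 = trans (+-cong refl (no-constant L f)) (+-identityʳ 1#)
    u-suc : ∀ i → u (suc i) ≈ - (L * f i)
    u-suc i = trans (+-identityˡ _) (-‿cong (*-cong refl (zS-⊛-suc f i)))

  nu-step : ∀ L (h : Series) → IsNuStep L h (inv1 ((one ⊕ zS) ⊕ (⊝ (scale L (zS ⊛ h)))))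
  nu-step L h = +-identityˡ 1# , λ n → x∙y⁻¹≈ε⇒x≈y _ _ (begin
      (g (suc n) + g n) + - (L * (h ⊛ g) n)        ≈⟨ +-assoc _ _ _ ⟩
      g (suc n) + (g n + - (L * (h ⊛ g) n))
        ≈⟨ +-cong refl (+-cong (sym (zS-tail g n)) (sym (neg-scaled-⊛ L h g n))) ⟩
      g (suc n) + (sumTo (suc n) (λ i → zS (suc i) * g (n ∸ i))
                   + sumTo (suc n) (λ i → - (L * h i) * g (n ∸ i)))
        ≈⟨ +-cong refl (sym (sum-+ (suc n) _ _)) ⟩
      g (suc n) + sumTo (suc n) (λ i → zS (suc i) * g (n ∸ i) + - (L * h i) * g (n ∸ i))
        ≈⟨ +-cong refl (sum-cong (suc n) (λ i _ → trans (sym (distribʳ _ _ _)) (*-cong (sym (u-suc i)) refl))) ⟩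
      g (suc n) + sumTo (suc n) (λ i → u (suc i) * g (n ∸ i))  ≈⟨ inverse-recurrence u u0≈1 n ⟩
      0#                                                        ∎)
    where
    u : Series
    u = (one ⊕ zS) ⊕ (⊝ (scale L (zS ⊛ h)))
    g : Series
    g = inv1 u
    u0≈1 : u 0 ≈ 1#
    u0≈1 = trans (+-cong (+-identityʳ 1#) (no-constant L h)) (+-identityʳ 1#)
    u-suc : ∀ i → u (suc i) ≈ zS (suc i) + - (L * h i)
    u-suc i = +-cong (+-identityˡ _) (-‿cong (*-cong refl (zS-⊛-suc h i)))

-- E n k and O n k are generated from E 0 k = [k = 0] by
--   O n k = E n k + E n (k+1),   E (n+1) k = O n (k-1) + O n k,
-- and turn out to be  C(2n, n-k) - C(2n, n-k-1)  and  C(2n+1, n-k) - C(2n+1, n-k-1).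
module BallotTriangle {c ℓ : Level} (R : CommutativeRing c ℓ) where
  open CommutativeRing R
  open FPS R
  open Summation R
  open SetoidReasoning setoid
  open RingSolver (fromCommutativeRing R (λ _ → nothing)) using (solve; _⊜_)
    renaming (_⊕_ to _:+_; ⊝_ to :-_)
  open import Algebra.Properties.Group +-group using (ε⁻¹≈ε)

  E O : ℕ → ℕ → Carrier
  E zero    zero    = 1#
  E zero    (suc k) = 0#
  E (suc n) zero    = O n 0
  E (suc n) (suc k) = O n k + O n (suc k)
  O n k = E n k + E n (suc k)

  E-vanish : ∀ n k → n < k → E n k ≈ 0#
  O-vanish : ∀ n k → n < k → O n k ≈ 0#
  E-vanish zero    (suc k) _           = refl
  E-vanish (suc n) (suc k) (s≤s n<k) =
    trans (+-cong (O-vanish n k n<k) (O-vanish n (suc k) (ℕₚ.m<n⇒m<1+n n<k))) (+-identityˡ 0#)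
  O-vanish n k n<k =
    trans (+-cong (E-vanish n k n<k) (E-vanish n (suc k) (ℕₚ.m<n⇒m<1+n n<k))) (+-identityˡ 0#)

  E-index : ∀ n {k k′} → k ≡ k′ → E n k ≈ E n k′
  E-index n eq = reflexive (≡.cong (E n) eq)

  E₀-* : ∀ i j → E 0 i * E 0 j ≈ E 0 (i ℕ.+ j)
  E₀-* zero    zero    = *-identityˡ 1#
  E₀-* zero    (suc j) = zeroʳ 1#
  E₀-* (suc i) j       = zeroˡ (E 0 j)

  -- The convolution identity  Σ_a E a i · E (n-a) j = O n (i+j).  In generating
  -- function terms: the columns of E are powers of a single series, and O is
  -- the row-shifted triangle.
  E-convolution  : ∀ n i j → sumTo (suc n) (λ a → E a i * E (n ∸ a) j) ≈ O n (i ℕ.+ j)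
  EO-convolution : ∀ n i j → sumTo (suc n) (λ a → E a i * O (n ∸ a) j) ≈ E (suc n) (suc (i ℕ.+ j))
  EO-convolution n i j = begin
    sumTo (suc n) (λ a → E a i * O (n ∸ a) j)
      ≈⟨ trans (sum-cong (suc n) (λ a _ → distribˡ _ _ _)) (sum-+ (suc n) _ _) ⟩
    sumTo (suc n) (λ a → E a i * E (n ∸ a) j) + sumTo (suc n) (λ a → E a i * E (n ∸ a) (suc j))
      ≈⟨ +-cong (E-convolution n i j) (E-convolution n i (suc j)) ⟩
    O n (i ℕ.+ j) + O n (i ℕ.+ suc j)
      ≈⟨ +-cong refl (reflexive (≡.cong (O n) (ℕₚ.+-suc i j))) ⟩
    E (suc n) (suc (i ℕ.+ j))  ∎
  E-convolution zero    i j =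
    trans (+-identityˡ _) (trans (E₀-* i j) (sym (+-identityʳ _)))
  E-convolution (suc n) i j = begin
    sumTo (suc n) (λ a → E a i * E (suc n ∸ a) j) + E (suc n) i * E (n ∸ n) j
      ≈⟨ +-cong (sum-cong (suc n) (λ a a<1+n → E-*-index a (ℕₚ.+-∸-assoc 1 (ℕₚ.<⇒≤pred a<1+n))))
                (E-*-index (suc n) (ℕₚ.n∸n≡0 n)) ⟩
    sumTo (suc n) (λ a → E a i * E (suc (n ∸ a)) j) + E (suc n) i * E 0 j
      ≈⟨ last-row j ⟩
    O (suc n) (i ℕ.+ j)  ∎
    where
    E-*-index : ∀ a {m m′} → m ≡ m′ → E a i * E m j ≈ E a i * E m′ j
    E-*-index a eq = *-cong refl (reflexive (≡.cong (λ m → E m j) eq))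

    last-row : ∀ j → sumTo (suc n) (λ a → E a i * E (suc (n ∸ a)) j) + E (suc n) i * E 0 j
                     ≈ O (suc n) (i ℕ.+ j)
    last-row zero = begin
      sumTo (suc n) (λ a → E a i * O (n ∸ a) 0) + E (suc n) i * 1#
        ≈⟨ +-cong (EO-convolution n i 0) (*-identityʳ _) ⟩
      E (suc n) (suc (i ℕ.+ 0)) + E (suc n) i   ≈⟨ +-comm _ _ ⟩
      E (suc n) i + E (suc n) (suc (i ℕ.+ 0))   ≈⟨ +-cong (E-index (suc n) (≡.sym (ℕₚ.+-identityʳ i))) refl ⟩
      O (suc n) (i ℕ.+ 0)                       ∎
    last-row (suc j) = begin
      sumTo (suc n) (λ a → E a i * (O (n ∸ a) j + O (n ∸ a) (suc j))) + E (suc n) i * 0#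
        ≈⟨ +-cong (trans (sum-cong (suc n) (λ a _ → distribˡ _ _ _)) (sum-+ (suc n) _ _)) (zeroʳ _) ⟩
      (sumTo (suc n) (λ a → E a i * O (n ∸ a) j) + sumTo (suc n) (λ a → E a i * O (n ∸ a) (suc j))) + 0#
        ≈⟨ +-identityʳ _ ⟩
      sumTo (suc n) (λ a → E a i * O (n ∸ a) j) + sumTo (suc n) (λ a → E a i * O (n ∸ a) (suc j))
        ≈⟨ +-cong (EO-convolution n i j) (EO-convolution n i (suc j)) ⟩
      E (suc n) (suc (i ℕ.+ j)) + E (suc n) (suc (i ℕ.+ suc j))
        ≈⟨ +-cong (E-index (suc n) (≡.sym (ℕₚ.+-suc i j))) refl ⟩
      O (suc n) (i ℕ.+ suc j)  ∎

  -- C(L, d-1), with the convention C(L, -1) = 0.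
  Cprev : ℕ → ℕ → ℕ
  Cprev L zero    = 0
  Cprev L (suc d) = L C d

  D : ℕ → ℕ → Carrier
  D L d = fromℕ (L C d) + - fromℕ (Cprev L d)

  fromℕ-+ : ∀ a b → fromℕ (a ℕ.+ b) ≈ fromℕ a + fromℕ b
  fromℕ-+ zero    b = sym (+-identityˡ _)
  fromℕ-+ (suc a) b = trans (+-cong refl (fromℕ-+ a b)) (sym (+-assoc _ _ _))

  D-pascal : ∀ L d → D L (suc d) + D L d ≈ D (suc L) (suc d)
  D-pascal L d = begin
    D L (suc d) + D L d
      ≈⟨ solve 4 (λ a b c e → ((b :+ (:- c)) :+ (a :+ (:- e))) ⊜ ((a :+ b) :+ (:- (c :+ e)))) refl _ _ _ _ ⟩
    (fromℕ (L C d) + fromℕ (L C suc d)) + - (fromℕ (Cprev L (suc d)) + fromℕ (Cprev L d))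
      ≈⟨ sym (+-cong (fromℕ-+ (L C d) (L C suc d)) (-‿cong (fromℕ-+ (Cprev L (suc d)) (Cprev L d)))) ⟩
    fromℕ (L C d ℕ.+ L C suc d) + - fromℕ (Cprev L (suc d) ℕ.+ Cprev L d)
      ≈⟨ +-cong (reflexive (≡.cong fromℕ (nCk+nC[k+1]≡[n+1]C[k+1] L d)))
                (-‿cong (reflexive (≡.cong fromℕ (Cprev-pascal d)))) ⟩
    D (suc L) (suc d)  ∎
    where
    Cprev-pascal : ∀ d → Cprev L (suc d) ℕ.+ Cprev L d ≡ Cprev (suc L) (suc d)
    Cprev-pascal zero    = ≡.refl
    Cprev-pascal (suc d) = ≡.trans (ℕₚ.+-comm (L C suc d) (L C d)) (nCk+nC[k+1]≡[n+1]C[k+1] L d)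

  -- Pascal's rule at the index n - k, the form in which the recursions for E and O use it.
  D-step : ∀ L n k → k < n → D L (n ∸ k) + D L (n ∸ suc k) ≈ D (suc L) (n ∸ k)
  D-step L n k k<n = begin
    D L (n ∸ k) + D L (n ∸ suc k)         ≡⟨ ≡.cong (λ d → D L d + D L (n ∸ suc k)) n∸k≡1+m ⟩
    D L (suc (n ∸ suc k)) + D L (n ∸ suc k) ≈⟨ D-pascal L (n ∸ suc k) ⟩
    D (suc L) (suc (n ∸ suc k))           ≡⟨ ≡.cong (D (suc L)) (≡.sym n∸k≡1+m) ⟩
    D (suc L) (n ∸ k)                     ∎
    where
    n∸k≡1+m : n ∸ k ≡ suc (n ∸ suc k)
    n∸k≡1+m = ℕₚ.+-∸-assoc 1 k<n

  D-zero : ∀ L → D L 0 ≈ 1#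
  D-zero L = trans (+-cong (+-identityʳ 1#) ε⁻¹≈ε) (+-identityʳ 1#)

  D-diagonal : ∀ L n → D L (n ∸ n) ≈ 1#
  D-diagonal L n = trans (reflexive (≡.cong (D L) (ℕₚ.n∸n≡0 n))) (D-zero L)

  -- Row 2n+1 of Pascal's triangle is symmetric, so its central ballot difference vanishes.
  D-central : ∀ n → D (suc (2 ℕ.* n)) (suc n) ≈ 0#
  D-central n = trans (+-cong (reflexive (≡.cong fromℕ symmetric)) refl) (-‿inverseʳ _)
    where
    symmetric : suc (2 ℕ.* n) C suc n ≡ suc (2 ℕ.* n) C n
    symmetric = ≡.trans (nCk≡nC[n∸k] (s≤s (ℕₚ.m≤m+n n (n ℕ.+ 0))))
                        (≡.cong (suc (2 ℕ.* n) C_) (≡.trans (ℕₚ.m+n∸m≡n n (n ℕ.+ 0)) (ℕₚ.+-identityʳ n)))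

  -- On the diagonal k = n both closed forms equal 1; this is the sum of 1 and a vanishing term.
  diagonal : ∀ L n {x y} → x ≈ 1# → y ≈ 0# → x + y ≈ D L (n ∸ n)
  diagonal L n x≈1 y≈0 = trans (+-cong x≈1 y≈0) (trans (+-identityʳ 1#) (sym (D-diagonal L n)))

  E-closed : ∀ n k → k ≤ n → E n k ≈ D (2 ℕ.* n) (n ∸ k)
  O-closed : ∀ n k → k ≤ n → O n k ≈ D (suc (2 ℕ.* n)) (n ∸ k)
  O-closed n k k≤n with ℕₚ.m≤n⇒m<n∨m≡n k≤n
  ... | inj₁ k<n = begin
    E n k + E n (suc k)                            ≈⟨ +-cong (E-closed n k k≤n) (E-closed n (suc k) k<n) ⟩
    D (2 ℕ.* n) (n ∸ k) + D (2 ℕ.* n) (n ∸ suc k)  ≈⟨ D-step (2 ℕ.* n) n k k<n ⟩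
    D (suc (2 ℕ.* n)) (n ∸ k)                      ∎
  ... | inj₂ ≡.refl =
    diagonal _ n (trans (E-closed n n k≤n) (D-diagonal _ n)) (E-vanish n (suc n) (ℕₚ.n<1+n n))
  E-closed zero    zero    _         = sym (D-zero 0)
  E-closed (suc n) zero    _         = begin
    O n 0                ≈⟨ O-closed n 0 z≤n ⟩
    D L n                ≈⟨ sym (+-identityˡ _) ⟩
    0# + D L n           ≈⟨ +-cong (sym (D-central n)) refl ⟩
    D L (suc n) + D L n  ≈⟨ D-step L (suc n) 0 (s≤s z≤n) ⟩
    D (suc L) (suc n)    ≡⟨ ≡.cong (λ m → D m (suc n)) (≡.sym (ℕₚ.*-suc 2 n)) ⟩
    D (2 ℕ.* suc n) (suc n) ∎
    where
    L : ℕ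
    L = suc (2 ℕ.* n)
  E-closed (suc n) (suc k) (s≤s k≤n) with ℕₚ.m≤n⇒m<n∨m≡n k≤n
  ... | inj₁ k<n = begin
    O n k + O n (suc k)            ≈⟨ +-cong (O-closed n k k≤n) (O-closed n (suc k) k<n) ⟩
    D L (n ∸ k) + D L (n ∸ suc k)  ≈⟨ D-step L n k k<n ⟩
    D (suc L) (n ∸ k)              ≡⟨ ≡.cong (λ m → D m (n ∸ k)) (≡.sym (ℕₚ.*-suc 2 n)) ⟩
    D (2 ℕ.* suc n) (n ∸ k)        ∎
    where
    L : ℕ
    L = suc (2 ℕ.* n)
  ... | inj₂ ≡.refl =
    diagonal _ n (trans (O-closed n n k≤n) (D-diagonal _ n)) (O-vanish n (suc n) (ℕₚ.n<1+n n))

  ballot≈E : ∀ n k → k ≤ n → ballot n k ≈ E n k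
  ballot≈E n k k≤n with k <? n
  ... | yes k<n = begin
    fromℕ (L C (n ∸ k)) + - fromℕ (L C (n ∸ k ∸ 1))
      ≡⟨ ≡.cong (λ d → fromℕ (L C d) + - fromℕ (L C (d ∸ 1))) n∸k≡1+m ⟩
    D L (suc (n ∸ suc k))  ≡⟨ ≡.cong (D L) (≡.sym n∸k≡1+m) ⟩
    D L (n ∸ k)            ≈⟨ sym (E-closed n k k≤n) ⟩
    E n k                  ∎
    where
    L : ℕ
    L = 2 ℕ.* n
    n∸k≡1+m : n ∸ k ≡ suc (n ∸ suc k)
    n∸k≡1+m = ℕₚ.+-∸-assoc 1 k<n
  ... | no k≮n = begin
    fromℕ (L C (n ∸ k))  ≡⟨ ≡.cong (λ d → fromℕ (L C d)) n∸k≡0 ⟩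
    1# + 0#              ≈⟨ +-identityʳ 1# ⟩
    1#                   ≈⟨ sym (D-zero L) ⟩
    D L 0                ≡⟨ ≡.cong (D L) (≡.sym n∸k≡0) ⟩
    D L (n ∸ k)          ≈⟨ sym (E-closed n k k≤n) ⟩
    E n k                ∎
    where
    L : ℕ
    L = 2 ℕ.* n
    n∸k≡0 : n ∸ k ≡ 0
    n∸k≡0 = ℕₚ.m≤n⇒m∸n≡0 (ℕₚ.≮⇒≥ k≮n)

-- The ballot transform  (Φ H)_n = Σ_k E n k · H_k.  Its key property: it turns
-- a solution of  H = 1/(1 + z - L z h)  into a solution of  Φ H = 1/(1 - L z Φ h).
module BallotTransform {c ℓ : Level} (R : CommutativeRing c ℓ) where
  open CommutativeRing R
  open FPS R
  open Summation R
  open SeriesAlgebra R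
  open BallotTriangle R
  open SetoidReasoning setoid
  open RingSolver (fromCommutativeRing R (λ _ → nothing)) using (solve; _⊜_)
    renaming (_⊕_ to _:+_; _⊗_ to _:*_)

  Φ : Series → Series
  Φ H n = sumTo (suc n) (λ k → E n k * H k)

  -- Since E (m+1) k = O m (k-1) + O m k, one step of Φ is a sum against row m of O.
  Φ-suc : ∀ (H : Series) m → Φ H (suc m) ≈ sumTo (suc m) (λ k → O m k * (H k + H (suc k)))
  Φ-suc H m = begin
    Φ H (suc m) ≈⟨ sum-head (suc m) _ ⟩
    O m 0 * H 0 + sumTo (suc m) (λ k → (O m k + O m (suc k)) * H (suc k))
      ≈⟨ +-cong refl (trans (sum-cong (suc m) (λ k _ → distribʳ _ _ _)) (sum-+ (suc m) _ _)) ⟩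
    O m 0 * H 0 + (sumTo (suc m) (λ k → O m k * H (suc k))
                   + (sumTo m (λ k → O m (suc k) * H (suc k)) + O m (suc m) * H (suc m)))
      ≈⟨ +-cong refl (+-cong refl (trans (+-cong refl (trans (*-cong (O-vanish m (suc m) (ℕₚ.n<1+n m)) refl)
                                                             (zeroˡ _)))
                                         (+-identityʳ _))) ⟩
    O m 0 * H 0 + (sumTo (suc m) (λ k → O m k * H (suc k)) + sumTo m (λ k → O m (suc k) * H (suc k)))
      ≈⟨ solve 3 (λ a A B → (a :+ (A :+ B)) ⊜ ((a :+ B) :+ A)) refl _ _ _ ⟩
    (O m 0 * H 0 + sumTo m (λ k → O m (suc k) * H (suc k))) + sumTo (suc m) (λ k → O m k * H (suc k))
      ≈⟨ +-cong (sym (sum-head m _)) refl ⟩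
    sumTo (suc m) (λ k → O m k * H k) + sumTo (suc m) (λ k → O m k * H (suc k))
      ≈⟨ sym (trans (sum-cong (suc m) (λ k _ → distribˡ _ _ _)) (sum-+ (suc m) _ _)) ⟩
    sumTo (suc m) (λ k → O m k * (H k + H (suc k)))  ∎

  weighted-⊛ : ∀ M (o h H : Series) →
    sumTo M (λ k → o k * (h ⊛ H) k) ≈ sumTo M (λ i → h i * sumTo (M ∸ i) (λ j → o (i ℕ.+ j) * H j))
  weighted-⊛ zero    o h H = refl
  weighted-⊛ (suc M) o h H = begin
    sumTo (suc M) (λ k → o k * (h ⊛ H) k) ≈⟨ sum-head M _ ⟩
    o 0 * (h ⊛ H) 0 + sumTo M (λ k → o (suc k) * (h ⊛ H) (suc k))
      ≈⟨ +-cong (*-cong refl (+-identityˡ _)) (sum-cong M (λ k _ → *-cong refl (sum-head (suc k) _))) ⟩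
    o 0 * (h 0 * H 0) + sumTo M (λ k → o (suc k) * (h 0 * H (suc k) + (h′ ⊛ H) k))
      ≈⟨ +-cong refl (trans (sum-cong M (λ k _ → trans (distribˡ _ _ _) (+-cong (x*[y*z]≈y*[x*z] _ _ _) refl)))
                            (sum-+ M _ _)) ⟩
    o 0 * (h 0 * H 0) + (sumTo M (λ k → h 0 * (o (suc k) * H (suc k))) + sumTo M (λ k → o (suc k) * (h′ ⊛ H) k))
      ≈⟨ +-cong refl (+-cong (sym (sum-*ˡ M (h 0) _)) (weighted-⊛ M (λ k → o (suc k)) h′ H)) ⟩
    o 0 * (h 0 * H 0) + (h 0 * sumTo M (λ k → o (suc k) * H (suc k)) + rest)
      ≈⟨ solve 5 (λ a b c S r → ((a :* (b :* c)) :+ ((b :* S) :+ r)) ⊜ ((b :* ((a :* c) :+ S)) :+ r))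
               refl _ _ _ _ _ ⟩
    h 0 * (o 0 * H 0 + sumTo M (λ k → o (suc k) * H (suc k))) + rest
      ≈⟨ +-cong (*-cong refl (sym (sum-head M _))) refl ⟩
    h 0 * sumTo (suc M) (λ j → o j * H j) + rest  ≈⟨ sym (sum-head M _) ⟩
    sumTo (suc M) (λ i → h i * sumTo (suc M ∸ i) (λ j → o (i ℕ.+ j) * H j))  ∎
    where
    h′ : Series
    h′ i = h (suc i)
    rest : Carrier
    rest = sumTo M (λ i → h (suc i) * sumTo (M ∸ i) (λ j → o (suc (i ℕ.+ j)) * H j))
    x*[y*z]≈y*[x*z] : ∀ x y z → x * (y * z) ≈ y * (x * z)
    x*[y*z]≈y*[x*z] = solve 3 (λ x y z → (x :* (y :* z)) ⊜ (y :* (x :* z))) refl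

  -- The bilinear form  Σ_{i,j ≤ m} h_i H_j O m (i+j)  through which both sides
  -- of the Stieltjes recurrence for Φ H are expressed.
  pairing : ℕ → Series → Series → Carrier
  pairing m h H = sumTo (suc m) (λ i → sumTo (suc m) (λ j → (h i * H j) * O m (i ℕ.+ j)))

  Φ-⊛ : ∀ (h H : Series) m → (Φ h ⊛ Φ H) m ≈ pairing m h H
  Φ-⊛ h H m = begin
    (Φ h ⊛ Φ H) m
      ≈⟨ sum-cong (suc m) (λ a a<1+m → *-cong (pad a (ℕₚ.<⇒≤pred a<1+m) h) (pad (m ∸ a) (ℕₚ.m∸n≤m m a) H)) ⟩
    sumTo (suc m) (λ a → sumTo (suc m) (λ i → E a i * h i) * sumTo (suc m) (λ j → E (m ∸ a) j * H j))
      ≈⟨ sum-cong (suc m) (λ a _ → sum-product (suc m) (suc m) _ _) ⟩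
    sumTo (suc m) (λ a → sumTo (suc m) (λ i → sumTo (suc m) (λ j → (E a i * h i) * (E (m ∸ a) j * H j))))
      ≈⟨ trans (sum-swap (suc m) (suc m) _) (sum-cong (suc m) (λ i _ → sum-swap (suc m) (suc m) _)) ⟩
    sumTo (suc m) (λ i → sumTo (suc m) (λ j → sumTo (suc m) (λ a → (E a i * h i) * (E (m ∸ a) j * H j))))
      ≈⟨ sum-cong (suc m) (λ i _ → sum-cong (suc m) (λ j _ → collect i j)) ⟩
    pairing m h H  ∎
    where
    pad : ∀ a → a ≤ m → (F : Series) → Φ F a ≈ sumTo (suc m) (λ i → E a i * F i)
    pad a a≤m F = sym (sum-pad (suc m) _ (s≤s a≤m) (λ i a<i _ → trans (*-cong (E-vanish a i a<i) refl) (zeroˡ _)))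

    collect : ∀ i j → sumTo (suc m) (λ a → (E a i * h i) * (E (m ∸ a) j * H j)) ≈ (h i * H j) * O m (i ℕ.+ j)
    collect i j = begin
      sumTo (suc m) (λ a → (E a i * h i) * (E (m ∸ a) j * H j))
        ≈⟨ sum-cong (suc m) (λ a _ → solve 4 (λ x y z w → ((x :* y) :* (z :* w)) ⊜ ((y :* w) :* (x :* z))) refl _ _ _ _) ⟩
      sumTo (suc m) (λ a → (h i * H j) * (E a i * E (m ∸ a) j))  ≈⟨ sym (sum-*ˡ (suc m) _ _) ⟩
      (h i * H j) * sumTo (suc m) (λ a → E a i * E (m ∸ a) j)   ≈⟨ *-cong refl (E-convolution m i j) ⟩
      (h i * H j) * O m (i ℕ.+ j)                               ∎

  Φ-step : ∀ L (h H : Series) → IsNuStep L h H → IsStieltjesStep L (Φ h) (Φ H)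
  Φ-step L h H (H0≈1 , H-suc) = trans (+-identityˡ _) (trans (*-identityˡ _) H0≈1) , Φ-suc≈
    where
    Φ-suc≈ : ∀ m → Φ H (suc m) ≈ L * (Φ h ⊛ Φ H) m
    Φ-suc≈ m = begin
      Φ H (suc m)                                       ≈⟨ Φ-suc H m ⟩
      sumTo (suc m) (λ k → O m k * (H k + H (suc k)))
        ≈⟨ sum-cong (suc m) (λ k _ → *-cong refl (trans (+-comm _ _) (H-suc k))) ⟩
      sumTo (suc m) (λ k → O m k * (L * (h ⊛ H) k))
        ≈⟨ sum-cong (suc m) (λ k _ → solve 3 (λ a b c → (a :* (b :* c)) ⊜ (b :* (a :* c))) refl _ _ _) ⟩
      sumTo (suc m) (λ k → L * (O m k * (h ⊛ H) k))     ≈⟨ sym (sum-*ˡ (suc m) L _) ⟩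
      L * sumTo (suc m) (λ k → O m k * (h ⊛ H) k)       ≈⟨ *-cong refl (weighted-⊛ (suc m) (O m) h H) ⟩
      L * sumTo (suc m) (λ i → h i * sumTo (suc m ∸ i) (λ j → O m (i ℕ.+ j) * H j))
        ≈⟨ *-cong refl (sum-cong (suc m) (λ i _ → *-cong refl (pad i))) ⟩
      L * sumTo (suc m) (λ i → h i * sumTo (suc m) (λ j → O m (i ℕ.+ j) * H j))
        ≈⟨ *-cong refl (sum-cong (suc m) (λ i _ → trans (sum-*ˡ (suc m) _ _)
             (sum-cong (suc m) (λ j _ → solve 3 (λ a b c → (a :* (b :* c)) ⊜ ((a :* c) :* b)) refl _ _ _)))) ⟩
      L * pairing m h H                                 ≈⟨ *-cong refl (sym (Φ-⊛ h H m)) ⟩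
      L * (Φ h ⊛ Φ H) m                                 ∎
      where
      -- O m (i+j) vanishes once i + j > m, so the inner sum may run up to m.
      pad : ∀ i → sumTo (suc m ∸ i) (λ j → O m (i ℕ.+ j) * H j) ≈ sumTo (suc m) (λ j → O m (i ℕ.+ j) * H j)
      pad i = sym (sum-pad (suc m) _ (ℕₚ.m∸n≤m (suc m) i) (λ j m+1-i≤j _ →
        trans (*-cong (O-vanish m (i ℕ.+ j) (ℕₚ.≤-trans (ℕₚ.m≤n+m∸n (suc m) i) (ℕₚ.+-monoʳ-≤ i m+1-i≤j))) refl)
              (zeroˡ _)))

  stieltjes-unique : ∀ {L} {f f′ g g′ : Series} → IsStieltjesStep L f g → IsStieltjesStep L f′ g′ →
    ∀ m → (∀ i → i < m → f i ≈ f′ i) → ∀ i → i ≤ m → g i ≈ g′ i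
  stieltjes-unique {L} {f} {f′} {g} {g′} (g0≈1 , g-suc) (g′0≈1 , g′-suc) m f≈f′ = up-to m ℕₚ.≤-refl
    where
    up-to : ∀ n → n ≤ m → ∀ i → i ≤ n → g i ≈ g′ i
    up-to zero    _   zero z≤n = trans g0≈1 (sym g′0≈1)
    up-to (suc n) n<m i    i≤1+n with ℕₚ.m≤n⇒m<n∨m≡n i≤1+n
    ... | inj₁ (s≤s i≤n) = up-to n (ℕₚ.<⇒≤ n<m) i i≤n
    ... | inj₂ ≡.refl    = begin
      g (suc n)          ≈⟨ g-suc n ⟩
      L * (f ⊛ g) n      ≈⟨ *-cong refl (sum-cong (suc n) (λ a a<1+n →
                              *-cong (f≈f′ a (ℕₚ.<-≤-trans a<1+n n<m))
                                     (up-to n (ℕₚ.<⇒≤ n<m) (n ∸ a) (ℕₚ.m∸n≤m n a)))) ⟩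
      L * (f′ ⊛ g′) n    ≈⟨ sym (g′-suc n) ⟩
      g′ (suc n)         ∎

  truncations-agree : ∀ (lam : ℕ → Carrier) d j i → i < d →
    stieltjesTrunc lam d j i ≈ Φ (nuTrunc lam d j) i
  truncations-agree lam (suc d) j i (s≤s i≤d) =
    stieltjes-unique {g = stieltjesTrunc lam (suc d) j} {g′ = Φ (nuTrunc lam (suc d) j)}
                     (stieltjes-step L (stieltjesTrunc lam d (suc j)))
                     (Φ-step L (nuTrunc lam d (suc j)) (nuTrunc lam (suc d) j) (nu-step L (nuTrunc lam d (suc j))))
                     d (truncations-agree lam d (suc j)) i i≤d
    where
    L : Carrier
    L = lam (suc j)

module Limits {c ℓ : Level} (R : CommutativeRing c ℓ) where
  open CommutativeRing R
  open FPS R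

  limit-uniform : ∀ {f : ℕ → Series} {s : Series} → IsLimit f s →
    ∀ n → ∃ λ D → ∀ d → D ≤ d → ∀ k → k ≤ n → f d k ≈ s k
  limit-uniform lim zero with lim 0
  ... | D , stable = D , λ { d D≤d .0 z≤n → stable d D≤d }
  limit-uniform lim (suc n) with limit-uniform lim n | lim (suc n)
  ... | D₁ , stable₁ | D₂ , stable₂ = D₁ ℕ.⊔ D₂ , both
    where
    both : ∀ d → D₁ ℕ.⊔ D₂ ≤ d → ∀ k → k ≤ suc n → _ ≈ _
    both d D≤d k k≤1+n with ℕₚ.m≤n⇒m<n∨m≡n k≤1+n
    ... | inj₁ (s≤s k≤n) = stable₁ d (ℕₚ.≤-trans (ℕₚ.m≤m⊔n D₁ D₂) D≤d) k k≤n
    ... | inj₂ ≡.refl    = stable₂ d (ℕₚ.≤-trans (ℕₚ.m≤n⊔m D₁ D₂) D≤d)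

lemma6p1 : {c ℓ : Level} (R : CommutativeRing c ℓ) (lam : ℕ → CommutativeRing.Carrier R)
    (μ ν : FPS.Series R) →
    FPS.IsLimit R (λ d → FPS.stieltjesTrunc R lam d 0) μ →
    FPS.IsLimit R (λ d → FPS.nuTrunc R lam d 0) ν →
    (n : ℕ) → CommutativeRing._≈_ R (μ n) (FPS.sumTo R (suc n) (λ k → CommutativeRing._*_ R (FPS.ballot R n k) (ν k)))
lemma6p1 R lam μ ν hμ hν n with hμ n | Limits.limit-uniform R hν n
... | Dμ , μ-stable | Dν , ν-stable = begin
  μ n                                     ≈⟨ sym (μ-stable d (ℕₚ.≤-trans (ℕₚ.m≤m⊔n Dμ Dν) D≤d)) ⟩
  stieltjesTrunc lam d 0 n                ≈⟨ truncations-agree lam d 0 n (ℕₚ.m≤n⊔m (Dμ ℕ.⊔ Dν) (suc n)) ⟩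
  Φ (nuTrunc lam d 0) n                   ≈⟨ sum-cong (suc n) (λ k k<1+n →
                                               *-cong (sym (ballot≈E n k (ℕₚ.<⇒≤pred k<1+n)))
                                                      (ν-stable d (ℕₚ.≤-trans (ℕₚ.m≤n⊔m Dμ Dν) D≤d) k (ℕₚ.<⇒≤pred k<1+n))) ⟩
  sumTo (suc n) (λ k → ballot n k * ν k)  ∎
  where
  open CommutativeRing R
  open FPS R
  open Summation R using (sum-cong)
  open BallotTriangle R using (ballot≈E)
  open BallotTransform R using (Φ; truncations-agree)
  open SetoidReasoning setoid

  -- A depth beyond both stabilisation points and beyond degree n.
  d : ℕ
  d = Dμ ℕ.⊔ Dν ℕ.⊔ suc n

  D≤d : Dμ ℕ.⊔ Dν ≤ d
  D≤d = ℕₚ.m≤m⊔n (Dμ ℕ.⊔ Dν) (suc n)
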